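{- Let $T$ be a Lyndon word with Lyndon SLP $\mathcal{G}$ and let $P$ be a pattern of length $m$. The number of partition pairs of $P$ that have an associated tuple of the form $(X_i,\varepsilon,\beta)$ (i.e. with empty $\alpha$) is $O(\lg m)$.
   Context: A string is a Lyndon word if it is lexicographically strictly smaller than each of its non-empty proper suffixes. The Lyndon SLP of a Lyndon word $T$ is the straight-line program (rules $X_i\to a$ or $X_i\to X_\ell X_r$) representing $T$ in which every variable derives a Lyndon word, every rule $X_i\to X_\ell X_r$ has $(\mathit{val}(X_\ell),\mathit{val}(X_r))$ equal to the standard factorization of $\mathit{val}(X_i)$ (i.e. $\mathit{val}(X_r)$ is the longest proper suffix of $\mathit{val}(X_i)$ that is Lyndon), and distinct variables derive distinct strings. A partition pair of $P[1..m]$ is $(P[1..i],P[i+1..m])$, $i\in[1..m]$, such that some rule $X_j\to X_\ell X_r$ has $P[1..i]$ as a suffix of $\mathit{val}(X_\ell)$ and $P[i+1..m]$ as a prefix of $\mathit{val}(X_r)$; writing $\mathit{val}(X_\ell)=\alpha P_L$ and $\mathit{val}(X_r)=P_R\beta$, $(X_j,\alpha,\beta)$ is a tuple associated with $(P_L,P_R)$; $\varepsilon$ denotes the empty string. -}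

module Defs where

open import Level using (0ℓ)
open import Data.Nat using (ℕ; zero; suc; _+_; _*_; _≤_)
open import Data.Nat.Logarithm using (⌊log₂_⌋)
open import Data.Fin using (Fin; zero; suc)
open import Data.List using (List; []; _∷_; _++_; length; take; drop)
open import Data.List.Relation.Unary.All using (All)
open import Data.List.Relation.Unary.Unique.Propositional using (Unique)
open import Data.Product using (Σ; ∃; ∃-syntax; _×_; _,_)
open import Relation.Binary.PropositionalEquality using (_≡_)
open import Relation.Binary.Definitions using (Trichotomous)
open import Relation.Binary.Structures using (IsStrictTotalOrder)
open import Relation.Nullary using (¬_)

record Alphabet : Set₁ where
  field
    Carrier : Set
    _≺_     : Carrier → Carrier → Set
    isSTO   : IsStrictTotalOrder _≡_ _≺_

module _ (Σ' : Alphabet) where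
  open Alphabet Σ'

  Str : Set
  Str = List Carrier

  data _<ₗ_ : Str → Str → Set where
    nil<  : ∀ {y ys} → [] <ₗ (y ∷ ys)
    head< : ∀ {x y xs ys} → x ≺ y → (x ∷ xs) <ₗ (y ∷ ys)
    tail< : ∀ {x xs ys} → xs <ₗ ys → (x ∷ xs) <ₗ (x ∷ ys)

  ProperSuffix : Str → Str → Set
  ProperSuffix s w = ∃[ u ] (¬ u ≡ []) × (¬ s ≡ []) × (w ≡ u ++ s)

  Lyndon : Str → Set
  Lyndon w = (¬ w ≡ []) × (∀ s → ProperSuffix s w → w <ₗ s)

  StdFact : Str → Str → Str → Set
  StdFact w u v =
    (w ≡ u ++ v) × (¬ u ≡ []) × (¬ v ≡ []) × Lyndon v ×
    (∀ s → ProperSuffix s w → Lyndon s → length s ≤ length v)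

  -- A program with n variables is a list of
  -- rules; the head of the list is the newest variable (the start
  -- variable), and a rule may only refer to variables occurring later
  -- in the list (i.e. defined earlier).

  data Rule (k : ℕ) : Set where
    term : Carrier → Rule k
    bin  : Fin k → Fin k → Rule k

  data SLP : ℕ → Set where
    []  : SLP 0
    _∷_ : ∀ {k} → Rule k → SLP k → SLP (suc k)

  -- rules with global variable indices (index zero = start variable)
  shift : ∀ {k} → Rule k → Rule (suc k)
  shift (term a)  = term a
  shift (bin l r) = bin (suc l) (suc r)

  ruleAt : ∀ {n} → SLP n → Fin n → Rule n
  ruleAt (r ∷ G) zero    = shift r
  ruleAt (r ∷ G) (suc i) = shift (ruleAt G i)

  val : ∀ {n} → SLP n → Fin n → Str
  val (term a  ∷ G) zero    = a ∷ []
  val (bin l r ∷ G) zero    = val G l ++ val G r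
  val (_       ∷ G) (suc i) = val G i

  data Reachable {k : ℕ} (G : SLP (suc k)) : Fin (suc k) → Set where
    start : Reachable G zero
    left  : ∀ {j l r} → Reachable G j → ruleAt G j ≡ bin l r → Reachable G l
    right : ∀ {j l r} → Reachable G j → ruleAt G j ≡ bin l r → Reachable G r

  IsLyndonSLP : ∀ {k} → SLP (suc k) → Str → Set
  IsLyndonSLP G T =
    (val G zero ≡ T) ×
    (∀ i → Lyndon (val G i)) ×
    (∀ i l r → ruleAt G i ≡ bin l r → StdFact (val G i) (val G l) (val G r)) ×
    (∀ i j → val G i ≡ val G j → i ≡ j) ×
    (∀ i → Reachable G i)

  -- (P[1..i], P[i+1..m]) is a partition pair of P having an associated
  -- tuple (X_j, ε, β): some rule X_j → X_l X_r with val(X_l) = P[1..i]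
  -- and P[i+1..m] a prefix of val(X_r).

  EmptyAlphaPartitionPair : ∀ {n} → SLP n → Str → ℕ → Set
  EmptyAlphaPartitionPair G P i =
    1 ≤ i × i ≤ length P ×
    ∃[ j ] ∃[ l ] ∃[ r ] (ruleAt G j ≡ bin l r) ×
      (val G l ≡ take i P) × (∃[ β ] val G r ≡ drop i P ++ β)

-- For the cut points a < b of two such pairs, write P = u x Y with |u| = a and |ux| = b.  Pair b comes
-- from a standard factorization (ux, Yβ'), and pair a from a Lyndon word xYβ.  Were
-- |x| < |Y|, the Lyndon property of xYβ and of Yβ' would force xYβ' < Yβ'; but then a
-- minimal suffix of x prepended to Yβ' is a Lyndon proper suffix longer than the right
-- factor Yβ', which is impossible.  Hence |Y| ≤ |x|: the distances m − a from the cut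
-- points to the end of P at least double from one cut point to the previous one, so
-- there are at most 2 + ⌊log₂ m⌋ of them.
module Submission where

open import Defs
open import Data.Nat using (ℕ; zero; suc; _+_; _*_; _∸_; _^_; _≤_; _<_; _≤?_; z≤n; s≤s)
open import Data.Nat.Properties
open import Data.Nat.Logarithm using (⌊log₂_⌋; ⌊log₂⌋-mono-≤; ⌊log₂[2^n]⌋≡n)
open import Data.List using (List; []; _∷_; _++_; length; take; drop; map; filter)
open import Data.List.Properties
  using (++-assoc; ++-identityʳ; ++-conicalˡ; ++-conicalʳ; ∷-injectiveˡ; ∷-injectiveʳ;
         length-++; length-++-≤ˡ; length-take; length-drop; length-map; take++drop≡id; take-[]; drop-drop)
open import Data.List.Membership.Propositional using (_∈_)
open import Data.List.Membership.Propositional.Properties using (∈-filter⁻; ∈-map⁻)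
open import Data.List.Relation.Unary.All as All using (All)
open import Data.List.Relation.Unary.All.Properties as All using ()
open import Data.List.Relation.Unary.AllPairs using ([]; _∷_)
open import Data.List.Relation.Unary.Any using (here; there)
open import Data.List.Relation.Unary.Unique.Propositional using (Unique)
open import Data.List.Relation.Unary.Unique.Propositional.Properties using (filter⁺)
open import Data.Product using (∃-syntax; _×_; _,_; proj₁; proj₂)
open import Data.Sum using (_⊎_; inj₁; inj₂; [_,_])
open import Data.Empty using (⊥; ⊥-elim)
open import Relation.Nullary using (¬_; yes; no)
open import Relation.Unary using (Decidable)
open import Relation.Unary.Properties using (∁?)
open import Relation.Binary.PropositionalEquality
  using (_≡_; _≢_; refl; sym; trans; cong; subst; subst₂; module ≡-Reasoning)
open import Relation.Binary.Definitions using (tri<; tri≈; tri>)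
open import Relation.Binary.Structures using (IsStrictTotalOrder)

module _ {X : Set} where

  Suffix : List X → List X → Set
  Suffix s x = ∃[ p ] x ≡ p ++ s

  suffix-refl : ∀ {x} → Suffix x x
  suffix-refl = [] , refl

  suffix-trans : ∀ {t s x} → Suffix t s → Suffix s x → Suffix t x
  suffix-trans {t} (q , refl) (p , refl) = p ++ q , sym (++-assoc p q t)

  suffix-∷ : ∀ {a s x} → Suffix s x → Suffix s (a ∷ x)
  suffix-∷ {a} (p , e) = a ∷ p , cong (a ∷_) e

  suffix-∷⁻ : ∀ {a s x} → Suffix s (a ∷ x) → s ≡ a ∷ x ⊎ Suffix s x
  suffix-∷⁻ ([]    , e) = inj₁ (sym e)
  suffix-∷⁻ (_ ∷ p , e) = inj₂ (p , ∷-injectiveʳ e)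

  suffix-[]⁻ : ∀ {s} → Suffix s [] → s ≡ []
  suffix-[]⁻ (p , e) = ++-conicalʳ p _ (sym e)

  ≢[]⁺ : ∀ {s : List X} → 0 < length s → s ≢ []
  ≢[]⁺ {[]} () _

  length-<-++ : ∀ {s : List X} v → s ≢ [] → length v < length (s ++ v)
  length-<-++ {[]}    v s≢[] = ⊥-elim (s≢[] refl)
  length-<-++ {a ∷ s} v _    = s≤s (≤-trans (m≤n+m (length v) (length s)) (≤-reflexive (sym (length-++ s))))

  ++-≢ : ∀ {s : List X} v → s ≢ [] → s ++ v ≢ v
  ++-≢ v s≢[] e = <-irrefl (cong length (sym e)) (length-<-++ v s≢[])

  ++-≡-++-split : ∀ (s v q r : List X) → s ++ v ≡ q ++ r →
    (∃[ t ] q ++ t ≡ s × r ≡ t ++ v) ⊎ (∃[ w ] s ++ w ≡ q × v ≡ w ++ r)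
  ++-≡-++-split []      v q       r e = inj₂ (q , refl , e)
  ++-≡-++-split (a ∷ s) v []      r e = inj₁ (a ∷ s , refl , sym e)
  ++-≡-++-split (a ∷ s) v (b ∷ q) r e with refl ← ∷-injectiveˡ e
    with ++-≡-++-split s v q r (∷-injectiveʳ e)
  ... | inj₁ (t , q++t≡s , r≡t++v) = inj₁ (t , cong (a ∷_) q++t≡s , r≡t++v)
  ... | inj₂ (w , s++w≡q , v≡w++r) = inj₂ (w , cong (a ∷_) s++w≡q , v≡w++r)

  length-take-≤ : ∀ {n} (xs : List X) → n ≤ length xs → length (take n xs) ≡ n
  length-take-≤ xs n≤ = trans (length-take _ xs) (m≤n⇒m⊓n≡m n≤)

  take-+ : ∀ a j (xs : List X) → take (a + j) xs ≡ take a xs ++ take j (drop a xs)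
  take-+ zero    j xs       = refl
  take-+ (suc a) j []       = sym (take-[] j)
  take-+ (suc a) j (x ∷ xs) = cong (x ∷_) (take-+ a j xs)

  take-≤-split : ∀ {a b} (xs : List X) → a ≤ b → take b xs ≡ take a xs ++ take (b ∸ a) (drop a xs)
  take-≤-split {a} {b} xs a≤b = begin
    take b xs                ≡⟨ cong (λ n → take n xs) (sym (m+[n∸m]≡n a≤b)) ⟩
    take (a + (b ∸ a)) xs    ≡⟨ take-+ a (b ∸ a) xs ⟩
    take a xs ++ take (b ∸ a) (drop a xs) ∎
    where open ≡-Reasoning

  drop-≤-split : ∀ {a b} (xs : List X) → a ≤ b → drop a xs ≡ take (b ∸ a) (drop a xs) ++ drop b xs
  drop-≤-split {a} {b} xs a≤b = begin
    drop a xs                                              ≡⟨ take++drop≡id (b ∸ a) (drop a xs) ⟨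
    take (b ∸ a) (drop a xs) ++ drop (b ∸ a) (drop a xs)   ≡⟨ cong (take (b ∸ a) (drop a xs) ++_) (drop-drop a (b ∸ a) xs) ⟩
    take (b ∸ a) (drop a xs) ++ drop (a + (b ∸ a)) xs      ≡⟨ cong (λ n → take (b ∸ a) (drop a xs) ++ drop n xs) (m+[n∸m]≡n a≤b) ⟩
    take (b ∸ a) (drop a xs) ++ drop b xs ∎
    where open ≡-Reasoning

module _ (A : Alphabet) where
  open Alphabet A
  open IsStrictTotalOrder isSTO using () renaming (compare to ≺-compare; trans to ≺-trans; irrefl to ≺-irrefl)

  infix 4 _⊏_ _⊑_

  _⊏_ : Str A → Str A → Set
  _⊏_ = _<ₗ_ A

  _⊑_ : Str A → Str A → Set
  a ⊑ b = a ⊏ b ⊎ a ≡ b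

  ⊏-trans : ∀ {a b c} → a ⊏ b → b ⊏ c → a ⊏ c
  ⊏-trans nil<      (head< _) = nil<
  ⊏-trans nil<      (tail< _) = nil<
  ⊏-trans (head< p) (head< q) = head< (≺-trans p q)
  ⊏-trans (head< p) (tail< _) = head< p
  ⊏-trans (tail< _) (head< q) = head< q
  ⊏-trans (tail< p) (tail< q) = tail< (⊏-trans p q)

  ⊏-irrefl : ∀ {a} → ¬ a ⊏ a
  ⊏-irrefl (head< p) = ≺-irrefl refl p
  ⊏-irrefl (tail< p) = ⊏-irrefl p

  ++-monoʳ-⊏ : ∀ c {a b} → a ⊏ b → c ++ a ⊏ c ++ b
  ++-monoʳ-⊏ []      p = p
  ++-monoʳ-⊏ (_ ∷ c) p = tail< (++-monoʳ-⊏ c p)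

  ⊑-refl : ∀ {a} → a ⊑ a
  ⊑-refl = inj₂ refl

  ⊑-trans : ∀ {a b c} → a ⊑ b → b ⊑ c → a ⊑ c
  ⊑-trans (inj₁ p)    (inj₁ q)    = inj₁ (⊏-trans p q)
  ⊑-trans (inj₁ p)    (inj₂ refl) = inj₁ p
  ⊑-trans (inj₂ refl) q           = q

  ⊑-⊏-trans : ∀ {a b c} → a ⊑ b → b ⊏ c → a ⊏ c
  ⊑-⊏-trans (inj₁ p)    q = ⊏-trans p q
  ⊑-⊏-trans (inj₂ refl) q = q

  prefix-⊑ : ∀ a t → a ⊑ a ++ t
  prefix-⊑ []      []      = ⊑-refl
  prefix-⊑ []      (_ ∷ _) = inj₁ nil<
  prefix-⊑ (x ∷ a) t with prefix-⊑ a t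
  ... | inj₁ lt = inj₁ (tail< lt)
  ... | inj₂ eq = inj₂ (cong (x ∷_) eq)

  data Divergence (a b : Str A) : Set where
    left-smaller  : (∀ r s → a ++ r ⊏ b ++ s) → Divergence a b
    right-smaller : (∀ r s → b ++ r ⊏ a ++ s) → Divergence a b
    left-extends  : ∀ t → a ≡ b ++ t → Divergence a b
    right-extends : ∀ t → b ≡ a ++ t → Divergence a b

  divergence : ∀ a b → Divergence a b
  divergence []      b       = right-extends b refl
  divergence (x ∷ a) []      = left-extends (x ∷ a) refl
  divergence (x ∷ a) (y ∷ b) with ≺-compare x y
  ... | tri< x≺y _ _ = left-smaller (λ _ _ → head< x≺y)
  ... | tri> _ _ y≺x = right-smaller (λ _ _ → head< y≺x)
  ... | tri≈ _ refl _ with divergence a b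
  ...   | left-smaller  lt  = left-smaller (λ r s → tail< (lt r s))
  ...   | right-smaller gt  = right-smaller (λ r s → tail< (gt r s))
  ...   | left-extends  t e = left-extends t (cong (x ∷_) e)
  ...   | right-extends t e = right-extends t (cong (x ∷_) e)

  ⊑-total : ∀ a b → a ⊑ b ⊎ b ⊑ a
  ⊑-total a b with divergence a b
  ... | left-smaller  lt     = inj₁ (inj₁ (subst₂ _⊏_ (++-identityʳ a) (++-identityʳ b) (lt [] [])))
  ... | right-smaller gt     = inj₂ (inj₁ (subst₂ _⊏_ (++-identityʳ b) (++-identityʳ a) (gt [] [])))
  ... | left-extends  t refl = inj₂ (prefix-⊑ b t)
  ... | right-extends t refl = inj₁ (prefix-⊑ a t)

  MinimalSuffix : Str A → Str A → Str A → Set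
  MinimalSuffix v x s = Suffix s x × s ≢ [] × (∀ t → Suffix t x → t ≢ [] → s ++ v ⊑ t ++ v)

  minimalSuffix : ∀ v a x → ∃[ s ] MinimalSuffix v (a ∷ x) s
  minimalSuffix v a [] = a ∷ [] , suffix-refl , (λ ()) , least
    where
    least : ∀ t → Suffix t (a ∷ []) → t ≢ [] → (a ∷ []) ++ v ⊑ t ++ v
    least t t⊒ t≢[] with suffix-∷⁻ t⊒
    ... | inj₁ refl = ⊑-refl
    ... | inj₂ t⊒[] = ⊥-elim (t≢[] (suffix-[]⁻ t⊒[]))
  minimalSuffix v a (b ∷ x) with minimalSuffix v b x
  ... | s , s⊒bx , s≢[] , least with ⊑-total ((a ∷ b ∷ x) ++ v) (s ++ v)
  ...   | inj₁ whole⊑s = a ∷ b ∷ x , suffix-refl , (λ ()) , λ t t⊒ t≢[] →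
            [ (λ { refl → ⊑-refl }) , (λ t⊒bx → ⊑-trans whole⊑s (least t t⊒bx t≢[])) ] (suffix-∷⁻ {a = a} t⊒)
  ...   | inj₂ s⊑whole = s , suffix-∷ s⊒bx , s≢[] , λ t t⊒ t≢[] →
            [ (λ { refl → s⊑whole }) , (λ t⊒bx → least t t⊒bx t≢[]) ] (suffix-∷⁻ {a = a} t⊒)

  -- Every proper suffix of y ++ v is either t ++ v for a proper suffix t of y, or a
  -- suffix of v; minimality of y handles the first kind and y ++ v ⊏ v the second.
  Lyndon-minimal-++ : ∀ {y v} → Lyndon A v → y ≢ [] → y ++ v ⊏ v →
    (∀ t → Suffix t y → t ≢ [] → y ++ v ⊑ t ++ v) → Lyndon A (y ++ v)
  Lyndon-minimal-++ {y} {v} (_ , v-least) y≢[] yv⊏v least =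
    (λ e → y≢[] (++-conicalˡ y v e)) , below
    where
    below : ∀ r → ProperSuffix A r (y ++ v) → y ++ v ⊏ r
    below r (q , q≢[] , _ , e) with ++-≡-++-split y v q r e
    ... | inj₁ ([] , _ , refl) = yv⊏v
    ... | inj₁ (t@(_ ∷ _) , refl , refl) with least t (q , refl) (λ ())
    ...   | inj₁ lt = lt
    ...   | inj₂ eq = ⊥-elim (++-≢ (t ++ v) q≢[] (trans (sym (++-assoc q t v)) eq))
    below r (q , _ , _ , e)       | inj₂ ([] , _ , refl) = yv⊏v
    below r (q , _ , r≢[] , e)    | inj₂ (w@(_ ∷ _) , _ , v≡wr) =
      ⊏-trans yv⊏v (v-least r (w , (λ ()) , r≢[] , v≡wr))

  StdFact-right-minimal : ∀ {w u x v} → StdFact A w (u ++ x) v → u ≢ [] → x ≢ [] → ¬ x ++ v ⊏ v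
  StdFact-right-minimal {x = []} _ _ x≢[] _ = x≢[] refl
  StdFact-right-minimal {u = u} {a ∷ x} {v} (refl , _ , _ , v-Lyndon , longest) u≢[] _ xv⊏v
    with minimalSuffix v a x
  ... | s , s⊒x@(p , ax≡ps) , s≢[] , least =
    <-irrefl refl (≤-<-trans (longest (s ++ v) proper sv-Lyndon) (length-<-++ v s≢[]))
    where
    sv⊏v : s ++ v ⊏ v
    sv⊏v = ⊑-⊏-trans (least (a ∷ x) suffix-refl (λ ())) xv⊏v
    sv-Lyndon : Lyndon A (s ++ v)
    sv-Lyndon = Lyndon-minimal-++ v-Lyndon s≢[] sv⊏v
      (λ t t⊒s t≢[] → least t (suffix-trans t⊒s s⊒x) t≢[])
    proper : ProperSuffix A (s ++ v) ((u ++ a ∷ x) ++ v)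
    proper = u ++ p , (λ e → u≢[] (++-conicalˡ u p e)) , (λ e → s≢[] (++-conicalˡ s v e)) , (begin
      (u ++ a ∷ x) ++ v      ≡⟨ cong (λ y → (u ++ y) ++ v) ax≡ps ⟩
      (u ++ p ++ s) ++ v     ≡⟨ cong (_++ v) (++-assoc u p s) ⟨
      ((u ++ p) ++ s) ++ v   ≡⟨ ++-assoc (u ++ p) s v ⟩
      (u ++ p) ++ s ++ v     ∎)
      where open ≡-Reasoning

  prepend-⊏ : ∀ {x Y z z'} → x ≢ [] → length x < length Y →
    Lyndon A (x ++ Y ++ z) → Lyndon A (Y ++ z') → x ++ Y ++ z' ⊏ Y ++ z'
  prepend-⊏ {x} {Y} {z} {z'} x≢[] |x|<|Y| (_ , xYz-least) (_ , Yz'-least) with divergence (x ++ Y) Y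
  ... | left-smaller lt = subst (_⊏ Y ++ z') (++-assoc x Y z') (lt z' z')
  ... | right-smaller gt =
    ⊥-elim (⊏-irrefl (⊏-trans (subst (Y ++ z ⊏_) (++-assoc x Y z) (gt z z))
                              (xYz-least (Y ++ z) (x , x≢[] , Yz≢[] , refl))))
    where
    Yz≢[] : Y ++ z ≢ []
    Yz≢[] e = ≢[]⁺ (≤-<-trans z≤n |x|<|Y|) (++-conicalˡ Y z e)
  ... | right-extends t Y≡xYt =
    ⊥-elim (<-irrefl refl (≤-<-trans (length-++-≤ˡ Y)
      (subst (length (Y ++ t) <_) (cong length (trans (sym (++-assoc x Y t)) (sym Y≡xYt)))
        (length-<-++ (Y ++ t) x≢[]))))
  ... | left-extends t xY≡Yt with ++-≡-++-split x Y Y t xY≡Yt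
  ...   | inj₁ (t' , refl , _) =
    ⊥-elim (<-irrefl refl (≤-<-trans (length-++-≤ˡ Y) |x|<|Y|))
  ...   | inj₂ ([] , x++[]≡Y , _) =
    ⊥-elim (<-irrefl (cong length (trans (sym (++-identityʳ x)) x++[]≡Y)) |x|<|Y|)
  ...   | inj₂ (w@(_ ∷ _) , refl , _) =
    subst (x ++ (x ++ w) ++ z' ⊏_) (sym (++-assoc x w z'))
      (++-monoʳ-⊏ x (Yz'-least (w ++ z') (x , x≢[] , (λ ()) , ++-assoc x w z')))

  emptyAlphaPair-gap : ∀ {k} {G : SLP A (suc k)} {T P : Str A} {a b} → IsLyndonSLP A G T →
    EmptyAlphaPartitionPair A G P a → EmptyAlphaPartitionPair A G P b → a < b → length P ∸ b ≤ b ∸ a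
  emptyAlphaPair-gap {G = G} {P = P} {a} {b} (_ , lyndon , standard , _)
    (1≤a , a≤m , _ , _ , r , _ , _ , β , val-r)
    (_ , b≤m , j , l' , r' , rule' , val-l' , β' , val-r') a<b
    with length P ∸ b ≤? b ∸ a
  ... | yes gap = gap
  ... | no gap≰ = ⊥-elim (StdFact-right-minimal stdFact u≢[] x≢[]
                    (prepend-⊏ {Y = Y} x≢[] |x|<|Y| xYβ-Lyndon Yβ'-Lyndon))
    where
    u = take a P
    x = take (b ∸ a) (drop a P)
    Y = drop b P
    u≢[] : u ≢ []
    u≢[] = ≢[]⁺ (subst (0 <_) (sym (length-take-≤ P a≤m)) 1≤a)
    |x|≡b∸a : length x ≡ b ∸ a
    |x|≡b∸a = length-take-≤ (drop a P)
      (subst (b ∸ a ≤_) (sym (length-drop a P)) (∸-monoˡ-≤ a b≤m))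
    x≢[] : x ≢ []
    x≢[] = ≢[]⁺ (subst (0 <_) (sym |x|≡b∸a) (m<n⇒0<n∸m a<b))
    |x|<|Y| : length x < length Y
    |x|<|Y| = subst₂ _<_ (sym |x|≡b∸a) (sym (length-drop b P)) (≰⇒> gap≰)
    xYβ-Lyndon : Lyndon A (x ++ Y ++ β)
    xYβ-Lyndon = subst (Lyndon A)
      (trans val-r (trans (cong (_++ β) (drop-≤-split P (<⇒≤ a<b))) (++-assoc x Y β))) (lyndon r)
    Yβ'-Lyndon : Lyndon A (Y ++ β')
    Yβ'-Lyndon = subst (Lyndon A) val-r' (lyndon r')
    stdFact : StdFact A (val A G j) (u ++ x) (Y ++ β')
    stdFact = subst₂ (StdFact A (val A G j)) (trans val-l' (take-≤-split P (<⇒≤ a<b))) val-r'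
      (standard j l' r' rule')

length≤1 : ∀ {X : Set} {xs : List X} → (∀ {x y} → x ∈ xs → y ∈ xs → x ≡ y) → Unique xs → length xs ≤ 1
length≤1 {xs = []}        _    _                  = z≤n
length≤1 {xs = _ ∷ []}    _    _                  = s≤s z≤n
length≤1 {xs = _ ∷ _ ∷ _} same ((x≢y All.∷ _) ∷ _) = ⊥-elim (x≢y (same (here refl) (there (here refl))))

length-filter-∁ : ∀ {X : Set} {P : X → Set} (P? : Decidable P) xs →
  length xs ≤ length (filter P? xs) + length (filter (∁? P?) xs)
length-filter-∁ P? []       = z≤n
length-filter-∁ P? (x ∷ xs) with P? x
... | yes _ = s≤s (length-filter-∁ P? xs)
... | no  _ = ≤-trans (s≤s (length-filter-∁ P? xs)) (≤-reflexive (sym (+-suc _ _)))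

Unique-map⁺ : ∀ {X Y : Set} {f : X → Y} {xs} →
  (∀ {x y} → x ∈ xs → y ∈ xs → f x ≡ f y → x ≡ y) → Unique xs → Unique (map f xs)
Unique-map⁺ {xs = []}     _   []           = []
Unique-map⁺ {xs = x ∷ xs} inj (x∉ ∷ uniq) =
  All.map⁺ (All.tabulate λ y∈ fx≡fy → All.lookup x∉ y∈ (inj (here refl) (there y∈) fx≡fy)) ∷
  Unique-map⁺ (λ x∈ y∈ → inj (there x∈) (there y∈)) uniq

Doubling : List ℕ → Set
Doubling ds = ∀ {d e} → d ∈ ds → e ∈ ds → d < e → 2 * d ≤ e

doubling-length : ∀ k {ds} → Unique ds → All (_< 2 ^ k) ds → Doubling ds → length ds ≤ suc k
doubling-length zero {ds} uniq bounded _ = length≤1 (λ d∈ e∈ → trans (≡0 d∈) (sym (≡0 e∈))) uniq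
  where
  ≡0 : ∀ {d} → d ∈ ds → d ≡ 0
  ≡0 d∈ = n<1⇒n≡0 (All.lookup bounded d∈)
doubling-length (suc k) {ds} uniq bounded doubling = begin
  length ds                                                  ≤⟨ length-filter-∁ large? ds ⟩
  length (filter large? ds) + length (filter (∁? large?) ds) ≤⟨ +-mono-≤ (length≤1 same (filter⁺ large? uniq)) small ⟩
  1 + suc k                                                  ∎
  where
  open ≤-Reasoning
  large? : Decidable (2 ^ k ≤_)
  large? = 2 ^ k ≤?_
  -- two large elements d < e would give 2 ^ suc k ≤ 2 * d ≤ e < 2 ^ suc k
  not-both-large : ∀ {d e} → d ∈ ds → e ∈ ds → 2 ^ k ≤ d → d < e → ⊥
  not-both-large d∈ e∈ large d<e = <-irrefl refl
    (≤-<-trans (≤-trans (*-monoʳ-≤ 2 large) (doubling d∈ e∈ d<e)) (All.lookup bounded e∈))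
  same : ∀ {d e} → d ∈ filter large? ds → e ∈ filter large? ds → d ≡ e
  same d∈ e∈ with ∈-filter⁻ large? d∈ | ∈-filter⁻ large? e∈
  ... | d∈ds , d-large | e∈ds , e-large with <-cmp _ _
  ...   | tri< d<e _ _ = ⊥-elim (not-both-large d∈ds e∈ds d-large d<e)
  ...   | tri≈ _ d≡e _ = d≡e
  ...   | tri> _ _ e<d = ⊥-elim (not-both-large e∈ds d∈ds e-large e<d)
  small : length (filter (∁? large?) ds) ≤ suc k
  small = doubling-length k (filter⁺ (∁? large?) uniq)
    (All.map ≰⇒> (All.all-filter (∁? large?) ds))
    (λ d∈ e∈ → doubling (proj₁ (∈-filter⁻ (∁? large?) d∈)) (proj₁ (∈-filter⁻ (∁? large?) e∈)))

[m∸n]+[n∸o]≡m∸o : ∀ {m n o} → o ≤ n → n ≤ m → (m ∸ n) + (n ∸ o) ≡ m ∸ o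
[m∸n]+[n∸o]≡m∸o {m} {n} {o} o≤n n≤m = begin
  (m ∸ n) + (n ∸ o)   ≡⟨ +-∸-assoc (m ∸ n) o≤n ⟨
  (m ∸ n + n) ∸ o     ≡⟨ cong (_∸ o) (m∸n+n≡m n≤m) ⟩
  m ∸ o               ∎
  where open ≡-Reasoning

gap⇒doubling : ∀ {m n o} → o ≤ n → n ≤ m → m ∸ n ≤ n ∸ o → 2 * (m ∸ n) ≤ m ∸ o
gap⇒doubling {m} {n} {o} o≤n n≤m gap = begin
  2 * (m ∸ n)         ≡⟨ cong ((m ∸ n) +_) (+-identityʳ (m ∸ n)) ⟩
  (m ∸ n) + (m ∸ n)   ≤⟨ +-monoʳ-≤ (m ∸ n) gap ⟩
  (m ∸ n) + (n ∸ o)   ≡⟨ [m∸n]+[n∸o]≡m∸o o≤n n≤m ⟩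
  m ∸ o               ∎
  where open ≤-Reasoning

n<2^suc⌊log₂n⌋ : ∀ n → n < 2 ^ suc ⌊log₂ n ⌋
n<2^suc⌊log₂n⌋ n with 2 ^ suc ⌊log₂ n ⌋ ≤? n
... | no  2^≰n = ≰⇒> 2^≰n
... | yes 2^≤n = ⊥-elim (<-irrefl refl
      (≤-trans (≤-reflexive (sym (⌊log₂[2^n]⌋≡n (suc ⌊log₂ n ⌋)))) (⌊log₂⌋-mono-≤ 2^≤n)))

module _ (A : Alphabet) {k} {G : SLP A (suc k)} {T : Str A} (G-Lyndon : IsLyndonSLP A G T)
         {P : Str A} {S : List ℕ} (pairs : All (EmptyAlphaPartitionPair A G P) S) where

  cutPoint≤length : ∀ {i} → i ∈ S → i ≤ length P
  cutPoint≤length i∈ = proj₁ (proj₂ (All.lookup pairs i∈))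

  distancesToEnd-doubling : Doubling (map (length P ∸_) S)
  distancesToEnd-doubling d∈ e∈ d<e with ∈-map⁻ (length P ∸_) d∈ | ∈-map⁻ (length P ∸_) e∈
  ... | a , a∈ , refl | b , b∈ , refl =
    gap⇒doubling (<⇒≤ b<a) (cutPoint≤length a∈)
      (emptyAlphaPair-gap A G-Lyndon (All.lookup pairs b∈) (All.lookup pairs a∈) b<a)
    where
    b<a : b < a
    b<a = ∸-cancelʳ-< d<e

  emptyAlphaPairs-length : Unique S → length S ≤ 2 + ⌊log₂ (length P) ⌋
  emptyAlphaPairs-length uniq = begin
    length S                     ≡⟨ length-map (length P ∸_) S ⟨
    length (map (length P ∸_) S) ≤⟨ doubling-length (suc ⌊log₂ length P ⌋) distinct bounded distancesToEnd-doubling ⟩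
    2 + ⌊log₂ (length P) ⌋       ∎
    where
    open ≤-Reasoning
    distinct : Unique (map (length P ∸_) S)
    distinct = Unique-map⁺ (λ i∈ j∈ → ∸-cancelˡ-≡ (cutPoint≤length i∈) (cutPoint≤length j∈)) uniq
    bounded : All (_< 2 ^ suc ⌊log₂ length P ⌋) (map (length P ∸_) S)
    bounded = All.map⁺ (All.tabulate λ {i} _ → ≤-<-trans (m∸n≤m (length P) i) (n<2^suc⌊log₂n⌋ (length P)))

corollary2 : ∃[ c ] ((A : Alphabet) → (T : Str A) → Lyndon A T →
                 (k : ℕ) → (G : SLP A (suc k)) → IsLyndonSLP A G T →
                 (P : Str A) → (S : List ℕ) → Unique S →
                 All (EmptyAlphaPartitionPair A G P) S →
                 length S ≤ c * ⌊log₂ (length P) ⌋ + c)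
corollary2 = 2 , λ A T _ k G G-Lyndon P S uniq pairs →
  ≤-trans (emptyAlphaPairs-length A G-Lyndon pairs uniq) (2+n≤2*n+2 ⌊log₂ (length P) ⌋)
  where
  2+n≤2*n+2 : ∀ n → 2 + n ≤ 2 * n + 2
  2+n≤2*n+2 n = subst (2 + n ≤_) (+-comm 2 (2 * n)) (+-monoʳ-≤ 2 (m≤m+n n (n + 0)))
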